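{- $\nu_2\bigl(B^{\pm}(x_m)\bigr)\geq m+5$ for all $m\geq0$.
   Context: $B^{\pm}(n)=\sum_{k=0}^n(-1)^kS(n,k)$ with $S(n,k)$ the Stirling numbers of the second kind; $\nu_2$ is the $2$-adic valuation with $\nu_2(0)=\infty$. Define $y_0=1$ and, for $m\ge0$, $y_{m+1}=y_m$ if $\nu_2(B^{\pm}(24y_m+14))>m+5$, and $y_{m+1}=2^m+y_m$ if $\nu_2(B^{\pm}(24y_m+14))\leq m+5$. Set $x_m=24y_m+14$. -}

module Defs where

open import Data.Nat as ℕ using (ℕ; zero; suc; _^_)
open import Data.Nat.DivMod using (_%_; _/_)
open import Data.Integer as ℤ using (ℤ; +_; -[1+_]; ∣_∣)
open import Data.List using (List; []; _∷_; map; upTo)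
open import Data.Bool using (Bool; true; false; if_then_else_)

S : ℕ → ℕ → ℕ
S zero    zero    = 1
S zero    (suc k) = 0
S (suc n) zero    = 0
S (suc n) (suc k) = suc k ℕ.* S n (suc k) ℕ.+ S n k

sign : ℕ → ℤ
sign zero          = + 1
sign (suc zero)    = ℤ.- (+ 1)
sign (suc (suc k)) = sign k

sumℤ : List ℤ → ℤ
sumℤ []       = + 0
sumℤ (x ∷ xs) = x ℤ.+ sumℤ xs

Bpm : ℕ → ℤ
Bpm n = sumℤ (map (λ k → sign k ℤ.* + S n k) (upTo (suc n)))

data ℕ∞ : Set where
  fin : ℕ → ℕ∞
  ∞   : ℕ∞

_≤∞_ : ℕ → ℕ∞ → Set
k ≤∞ fin v = k ℕ.≤ v
k ≤∞ ∞     = Data.Unit.⊤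
  where import Data.Unit

_<∞_ : ℕ → ℕ∞ → Set
k <∞ v = suc k ≤∞ v

-- 2-adic valuation of a positive natural, by fuel (fuel ≥ n suffices)
ν₂ℕ-fuel : ℕ → ℕ → ℕ
ν₂ℕ-fuel zero       n = 0
ν₂ℕ-fuel (suc fuel) zero = 0
ν₂ℕ-fuel (suc fuel) (suc n) with suc n % 2
... | zero  = suc (ν₂ℕ-fuel fuel (suc n / 2))
... | suc _ = 0

ν₂ : ℤ → ℕ∞
ν₂ z with ∣ z ∣
... | zero  = ∞
... | suc n = fin (ν₂ℕ-fuel (suc n) (suc n))

_<∞?_ : ℕ → ℕ∞ → Bool
k <∞? fin v = k ℕ.<ᵇ v
k <∞? ∞     = true

y : ℕ → ℕ
y zero    = 1
y (suc m) = if (m ℕ.+ 5) <∞? ν₂ (Bpm (24 ℕ.* y m ℕ.+ 14))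
            then y m
            else 2 ^ m ℕ.+ y m

x : ℕ → ℕ
x m = 24 ℕ.* y m ℕ.+ 14

-- In the falling-factorial basis, f ↦ x f(x) - f(x + 1) acts on coefficient sequences as a
-- tridiagonal operator T, and the recurrence of the Stirling numbers gives B±(n) = (Tⁿ δ₀)₀.
-- Conjugating by the weights 2^⌊i/2⌋ yields a tridiagonal M whose entries are 16-periodic
-- modulo 8, and a finite computation shows M²⁴ ≡ 1 (mod 8) entrywise. Since
-- A² - 1 = 2 (A - 1) + (A - 1)², the operator E_m = M^(24·2^m) is ≡ 1 modulo 2^(m+3), and along
-- the orbit x = 24 t + 14 one gets (E_m - 1)(Mˣ δ₀)₀ ≡ 2^(m+5) (mod 2^(m+6)), the case m = 0
-- being read off from B±(14), B±(38) and B±(62). So when 2^(m+5) divides B±(x_m) exactly,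
-- B±(x_m + 24·2^m) = B±(x_m) + (E_m - 1)(M^(x_m) δ₀)₀ is divisible by 2^(m+6).

module Submission where

open import Defs
open import Data.Bool using (true; false; if_then_else_)
import Data.Bool as Bool
open import Data.Empty using (⊥; ⊥-elim)
open import Data.Fin using (Fin; toℕ; fromℕ<)
import Data.Fin.Properties as FinP
open import Data.Integer using (ℤ; +_; _+_; _*_; -_; _-_; _^_; ∣_∣)
open import Data.Integer.DivMod using (_%ℕ_; _/ℕ_; a≡a%ℕn+[a/ℕn]*n; n%ℕd<d)
open import Data.Integer.Divisibility.Signed
  using (_∣_; module _∣_; divides; _∣?_; ∣ᵤ⇒∣; ∣⇒∣ᵤ; ∣m∣n⇒∣m+n; ∣m⇒∣-m; ∣n⇒∣m*n; ∣m⇒∣m*n; ∣-trans; *-monoʳ-∣)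
import Data.Integer.Properties as ℤP
open import Algebra.Properties.CommutativeSemigroup ℤP.+-commutativeSemigroup using (interchange)
open import Data.Integer.Tactic.RingSolver using (solve-∀)
open import Data.List using (List; []; _∷_; map; applyUpTo; replicate; _++_)
open import Data.List.Relation.Binary.Pointwise as Pointwise using (Pointwise; []; _∷_)
open import Data.List.Relation.Unary.All as All using (All; []; _∷_)
open import Data.Nat as ℕ using (ℕ; zero; suc; ⌊_/2⌋; NonZero)
open import Data.Nat.DivMod using (_/_; m≡m%n+[m/n]*n; m%n<n)
import Data.Nat.Divisibility as ℕ∣
import Data.Nat.Properties as ℕP
import Data.Nat.Tactic.RingSolver as ℕ-Solver
open import Data.Product using (_×_; _,_)
open import Data.Unit using (tt)
open import Function using (_∘_)
open import Function.Bundles using (_⇔_; mk⇔; Equivalence)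
open import Relation.Binary.PropositionalEquality
open import Relation.Nullary using (Dec; ¬_; yes; no; _×-dec_)
import Relation.Nullary.Decidable as Dec

open ≡-Reasoning

-- Finite sums and Stirling numbers

Seq : Set
Seq = ℕ → ℤ

infixl 6 _⊕_ _⊝_
infixl 7 _·_ _⊙_

_⊕_ _⊝_ _⊙_ : Seq → Seq → Seq
(c ⊕ d) i = c i + d i
(c ⊝ d) i = c i - d i
(c ⊙ d) i = c i * d i

_·_ : ℤ → Seq → Seq
(k · c) i = k * c i

∑ : ℕ → Seq → ℤ
∑ zero    f = + 0
∑ (suc n) f = f 0 + ∑ n (f ∘ suc)

∑-cong : ∀ n {f g : Seq} → f ≗ g → ∑ n f ≡ ∑ n g
∑-cong zero    f≗g = refl
∑-cong (suc n) f≗g = cong₂ _+_ (f≗g 0) (∑-cong n (f≗g ∘ suc))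

∑-⊕ : ∀ n (f g : Seq) → ∑ n (f ⊕ g) ≡ ∑ n f + ∑ n g
∑-⊕ zero    f g = refl
∑-⊕ (suc n) f g = begin
  (f 0 + g 0) + ∑ n (λ k → f (suc k) + g (suc k)) ≡⟨ cong (_+_ (f 0 + g 0)) (∑-⊕ n (f ∘ suc) (g ∘ suc)) ⟩
  (f 0 + g 0) + (∑ n (f ∘ suc) + ∑ n (g ∘ suc))   ≡⟨ interchange (f 0) (g 0) _ _ ⟩
  ∑ (suc n) f + ∑ (suc n) g                       ∎

∑-neg : ∀ n (f : Seq) → ∑ n (λ k → - f k) ≡ - ∑ n f
∑-neg zero    f = refl
∑-neg (suc n) f = trans (cong (_+_ (- f 0)) (∑-neg n (f ∘ suc))) (sym (ℤP.neg-distrib-+ (f 0) _))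

∑-⊝ : ∀ n (f g : Seq) → ∑ n (f ⊝ g) ≡ ∑ n f - ∑ n g
∑-⊝ n f g = trans (∑-⊕ n f (-_ ∘ g)) (cong (_+_ (∑ n f)) (∑-neg n g))

∑-*ˡ : ∀ n c (f : Seq) → ∑ n (λ k → c * f k) ≡ c * ∑ n f
∑-*ˡ zero    c f = sym (ℤP.*-zeroʳ c)
∑-*ˡ (suc n) c f = trans (cong (_+_ (c * f 0)) (∑-*ˡ n c (f ∘ suc))) (sym (ℤP.*-distribˡ-+ c (f 0) _))

∑-last : ∀ n (f : Seq) → ∑ (suc n) f ≡ ∑ n f + f n
∑-last zero    f = ℤP.+-comm (f 0) (+ 0)
∑-last (suc n) f = trans (cong (_+_ (f 0)) (∑-last n (f ∘ suc))) (sym (ℤP.+-assoc (f 0) _ _))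

∑-drop-last : ∀ n (f : Seq) → f n ≡ + 0 → ∑ (suc n) f ≡ ∑ n f
∑-drop-last n f fn≡0 = begin
  ∑ (suc n) f   ≡⟨ ∑-last n f ⟩
  ∑ n f + f n   ≡⟨ cong (_+_ (∑ n f)) fn≡0 ⟩
  ∑ n f + + 0   ≡⟨ ℤP.+-identityʳ _ ⟩
  ∑ n f         ∎

∑-shift : ∀ n (f : Seq) → f 0 ≡ + 0 → f n ≡ + 0 → ∑ n (f ∘ suc) ≡ ∑ n f
∑-shift n f f0≡0 fn≡0 = begin
  ∑ n (f ∘ suc)         ≡⟨ sym (ℤP.+-identityˡ _) ⟩
  + 0 + ∑ n (f ∘ suc)   ≡⟨ cong (λ t → t + ∑ n (f ∘ suc)) (sym f0≡0) ⟩
  ∑ (suc n) f           ≡⟨ ∑-drop-last n f fn≡0 ⟩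
  ∑ n f                 ∎

sumℤ-applyUpTo : ∀ n (g : ℕ → ℤ) (f : ℕ → ℕ) → sumℤ (map g (applyUpTo f n)) ≡ ∑ n (g ∘ f)
sumℤ-applyUpTo zero    g f = refl
sumℤ-applyUpTo (suc n) g f = cong (_+_ (g (f 0))) (sumℤ-applyUpTo n g (f ∘ suc))

Bpm≡∑ : ∀ n → Bpm n ≡ ∑ (suc n) (λ k → sign k * + S n k)
Bpm≡∑ n = sumℤ-applyUpTo (suc n) (λ k → sign k * + S n k) (λ k → k)

sign-suc : ∀ k → sign (suc k) ≡ - sign k
sign-suc zero    = refl
sign-suc (suc k) = trans (sym (ℤP.neg-involutive (sign k))) (cong -_ (sym (sign-suc k)))

S-vanishes : ∀ {n k} → n ℕ.< k → S n k ≡ 0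
S-vanishes {zero}  {suc k} _ = refl
S-vanishes {suc n} {suc k} (ℕ.s≤s n<k)
  rewrite S-vanishes (ℕP.m<n⇒m<1+n n<k) | S-vanishes n<k = trans (ℕP.+-identityʳ _) (ℕP.*-zeroʳ k)

∑-S-suc : ∀ n (f : Seq) →
  ∑ (suc (suc n)) (λ k → + S (suc n) k * f k) ≡ ∑ (suc n) (λ k → + S n k * (+ k * f k + f (suc k)))
∑-S-suc n f = begin
  + 0 + ∑ (suc n) (λ k → + S (suc n) (suc k) * f (suc k))   ≡⟨ ℤP.+-identityˡ _ ⟩
  ∑ (suc n) (λ k → + S (suc n) (suc k) * f (suc k))         ≡⟨ ∑-cong (suc n) split ⟩
  ∑ (suc n) (λ k → g (suc k) + h k)                         ≡⟨ ∑-⊕ (suc n) (g ∘ suc) h ⟩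
  ∑ (suc n) (g ∘ suc) + ∑ (suc n) h                         ≡⟨ cong (λ t → t + ∑ (suc n) h) (∑-shift (suc n) g (ℤP.*-zeroʳ (+ S n 0)) g[n+1]≡0) ⟩
  ∑ (suc n) g + ∑ (suc n) h                                 ≡⟨ sym (∑-⊕ (suc n) g h) ⟩
  ∑ (suc n) (λ k → g k + h k)                               ≡⟨ ∑-cong (suc n) (λ k → sym (ℤP.*-distribˡ-+ (+ S n k) (+ k * f k) (f (suc k)))) ⟩
  ∑ (suc n) (λ k → + S n k * (+ k * f k + f (suc k)))       ∎
  where
  g h : Seq
  g k = + S n k * (+ k * f k)
  h k = + S n k * f (suc k)

  g[n+1]≡0 : g (suc n) ≡ + 0
  g[n+1]≡0 = cong (λ s → + s * (+ suc n * f (suc n))) (S-vanishes (ℕP.n<1+n n))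

  split : ∀ k → + S (suc n) (suc k) * f (suc k) ≡ g (suc k) + h k
  split k = begin
    + (suc k ℕ.* S n (suc k) ℕ.+ S n k) * f (suc k)      ≡⟨ cong (_* f (suc k)) (ℤP.pos-+ (suc k ℕ.* S n (suc k)) (S n k)) ⟩
    (+ (suc k ℕ.* S n (suc k)) + + S n k) * f (suc k)    ≡⟨ cong (λ s → (s + + S n k) * f (suc k)) (ℤP.pos-* (suc k) (S n (suc k))) ⟩
    (+ suc k * + S n (suc k) + + S n k) * f (suc k)      ≡⟨ ring (+ suc k) (+ S n (suc k)) (+ S n k) (f (suc k)) ⟩
    g (suc k) + h k                                      ∎
    where
    ring : ∀ a b c x → (a * b + c) * x ≡ b * (a * x) + c * x
    ring = solve-∀

-- Linear and tridiagonal operators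

Op : Set
Op = Seq → Seq

record Linear (A : Op) : Set where
  field
    resp-≗      : ∀ {c d} → c ≗ d → A c ≗ A d
    additive    : ∀ c d → A (c ⊕ d) ≗ A c ⊕ A d
    homogeneous : ∀ k c → A (k · c) ≗ k · A c

  subtractive : ∀ c d → A (c ⊝ d) ≗ A c ⊝ A d
  subtractive c d i = begin
    A (c ⊝ d) i                  ≡⟨ resp-≗ (λ j → cong (_+_ (c j)) (sym (ℤP.-1*i≡-i (d j)))) i ⟩
    A (c ⊕ (- + 1) · d) i        ≡⟨ additive c ((- + 1) · d) i ⟩
    A c i + A ((- + 1) · d) i    ≡⟨ cong (_+_ (A c i)) (homogeneous (- + 1) d i) ⟩
    A c i + - + 1 * A d i        ≡⟨ cong (_+_ (A c i)) (ℤP.-1*i≡-i (A d i)) ⟩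
    A c i - A d i                ∎

open Linear

∘-linear : ∀ {A B} → Linear A → Linear B → Linear (A ∘ B)
∘-linear {A} {B} lin-A lin-B = record
  { resp-≗      = resp-≗ lin-A ∘ resp-≗ lin-B
  ; additive    = λ c d i → trans (resp-≗ lin-A (additive lin-B c d) i) (additive lin-A (B c) (B d) i)
  ; homogeneous = λ k c i → trans (resp-≗ lin-A (homogeneous lin-B k c) i) (homogeneous lin-A k (B c) i)
  }

_−id : Op → Op
(A −id) c = A c ⊝ c

−id-linear : ∀ {A} → Linear A → Linear (A −id)
−id-linear {A} lin-A = record
  { resp-≗      = λ c≗d i → cong₂ _-_ (resp-≗ lin-A c≗d i) (c≗d i)
  ; additive    = λ c d i → trans (cong (_- (c i + d i)) (additive lin-A c d i)) (ring₁ (A c i) (A d i) (c i) (d i))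
  ; homogeneous = λ k c i → trans (cong (_- k * c i) (homogeneous lin-A k c i)) (ring₂ k (A c i) (c i))
  }
  where
  ring₁ : ∀ a b c d → (a + b) - (c + d) ≡ (a - c) + (b - d)
  ring₁ = solve-∀
  ring₂ : ∀ k a c → k * a - k * c ≡ k * (a - c)
  ring₂ = solve-∀

-- Iterates are opaque: unfolding a concrete iterate such as (A ^[ 38 ]) c 0 during
-- conversion checking takes exponential time.
opaque
  _^[_] : Op → ℕ → Op
  (A ^[ zero ])  c = c
  (A ^[ suc n ]) c = (A ^[ n ]) (A c)

  ^[zero] : ∀ A c → (A ^[ zero ]) c ≡ c
  ^[zero] A c = refl

  ^[suc] : ∀ A n c → (A ^[ suc n ]) c ≡ (A ^[ n ]) (A c)
  ^[suc] A n c = refl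

  ^[+] : ∀ A a b c → (A ^[ a ℕ.+ b ]) c ≡ (A ^[ b ]) ((A ^[ a ]) c)
  ^[+] A zero    b c = refl
  ^[+] A (suc a) b c = ^[+] A a b (A c)

  ^[]-linear : ∀ {A} n → Linear A → Linear (A ^[ n ])
  ^[]-linear zero    lin-A = record { resp-≗ = λ c≗d → c≗d ; additive = λ _ _ _ → refl ; homogeneous = λ _ _ _ → refl }
  ^[]-linear (suc n) lin-A = ∘-linear (^[]-linear n lin-A) lin-A

^[*] : ∀ A a t c → (A ^[ t ℕ.* a ]) c ≡ ((A ^[ a ]) ^[ t ]) c
^[*] A a zero    c = trans (^[zero] A c) (sym (^[zero] (A ^[ a ]) c))
^[*] A a (suc t) c = begin
  (A ^[ a ℕ.+ t ℕ.* a ]) c             ≡⟨ ^[+] A a (t ℕ.* a) c ⟩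
  (A ^[ t ℕ.* a ]) ((A ^[ a ]) c)      ≡⟨ ^[*] A a t ((A ^[ a ]) c) ⟩
  ((A ^[ a ]) ^[ t ]) ((A ^[ a ]) c)   ≡⟨ sym (^[suc] (A ^[ a ]) t c) ⟩
  ((A ^[ a ]) ^[ suc t ]) c            ∎

prev : Seq → Seq
prev c zero    = + 0
prev c (suc i) = c i

tridiagonal : (l d u : ℕ → ℤ) → Op
tridiagonal l d u c i = l i * prev c i + d i * c i - u i * c (suc i)

tridiagonal-linear : ∀ l d u → Linear (tridiagonal l d u)
tridiagonal-linear l d u = record { resp-≗ = resp′ ; additive = additive′ ; homogeneous = homogeneous′ }
  where
  prev-resp : ∀ {c c′} → c ≗ c′ → prev c ≗ prev c′
  prev-resp c≗c′ zero    = refl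
  prev-resp c≗c′ (suc i) = c≗c′ i

  prev-⊕ : ∀ c c′ → prev (c ⊕ c′) ≗ prev c ⊕ prev c′
  prev-⊕ c c′ zero    = refl
  prev-⊕ c c′ (suc i) = refl

  prev-· : ∀ k c → prev (k · c) ≗ k · prev c
  prev-· k c zero    = sym (ℤP.*-zeroʳ k)
  prev-· k c (suc i) = refl

  resp′ : ∀ {c c′} → c ≗ c′ → tridiagonal l d u c ≗ tridiagonal l d u c′
  resp′ c≗c′ i = cong₂ _-_ (cong₂ _+_ (cong (l i *_) (prev-resp c≗c′ i)) (cong (d i *_) (c≗c′ i)))
                           (cong (u i *_) (c≗c′ (suc i)))

  additive′ : ∀ c c′ → tridiagonal l d u (c ⊕ c′) ≗ tridiagonal l d u c ⊕ tridiagonal l d u c′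
  additive′ c c′ i =
    trans (cong (λ p → l i * p + d i * (c i + c′ i) - u i * (c (suc i) + c′ (suc i))) (prev-⊕ c c′ i))
          (ring (l i) (d i) (u i) (prev c i) (prev c′ i) (c i) (c′ i) (c (suc i)) (c′ (suc i)))
    where
    ring : ∀ l d u p p′ a a′ s s′ →
      l * (p + p′) + d * (a + a′) - u * (s + s′) ≡ (l * p + d * a - u * s) + (l * p′ + d * a′ - u * s′)
    ring = solve-∀

  homogeneous′ : ∀ k c → tridiagonal l d u (k · c) ≗ k · tridiagonal l d u c
  homogeneous′ k c i =
    trans (cong (λ p → l i * p + d i * (k * c i) - u i * (k * c (suc i))) (prev-· k c i))
          (ring k (l i) (d i) (u i) (prev c i) (c i) (c (suc i)))
    where
    ring : ∀ k l d u p a s → l * (k * p) + d * (k * a) - u * (k * s) ≡ k * (l * p + d * a - u * s)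
    ring = solve-∀

-- The operators T and M

_↓_ : ℕ → ℕ → ℤ
j     ↓ zero  = + 1
zero  ↓ suc i = + 0
suc j ↓ suc i = + suc j * (j ↓ i)

↓-vanishes : ∀ j → j ↓ suc j ≡ + 0
↓-vanishes zero    = refl
↓-vanishes (suc j) = trans (cong (+ suc j *_) (↓-vanishes j)) (ℤP.*-zeroʳ (+ suc j))

*-↓ : ∀ j i → + j * (j ↓ i) ≡ j ↓ suc i + + i * (j ↓ i)
*-↓ zero    zero    = refl
*-↓ zero    (suc i) = sym (trans (ℤP.+-identityˡ _) (ℤP.*-zeroʳ (+ suc i)))
*-↓ (suc j) zero    = sym (ℤP.+-identityʳ _)
*-↓ (suc j) (suc i) = begin
  + suc j * (+ suc j * (j ↓ i))                             ≡⟨ ring₁ (+ j) (+ suc j) (j ↓ i) ⟩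
  + suc j * (+ j * (j ↓ i) + j ↓ i)                         ≡⟨ cong (λ t → + suc j * (t + j ↓ i)) (*-↓ j i) ⟩
  + suc j * (j ↓ suc i + + i * (j ↓ i) + j ↓ i)             ≡⟨ ring₂ (+ suc j) (j ↓ suc i) (+ i) (j ↓ i) ⟩
  + suc j * (j ↓ suc i) + + suc i * (+ suc j * (j ↓ i))      ∎
  where
  ring₁ : ∀ a b x → b * ((+ 1 + a) * x) ≡ b * (a * x + x)
  ring₁ = solve-∀
  ring₂ : ∀ b y a x → b * (y + a * x + x) ≡ b * y + (+ 1 + a) * (b * x)
  ring₂ = solve-∀

↓-suc : ∀ j i → suc j ↓ suc i ≡ j ↓ suc i + + suc i * (j ↓ i)
↓-suc j i = begin
  (+ 1 + + j) * (j ↓ i)                  ≡⟨ ring₁ (+ j) (j ↓ i) ⟩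
  j ↓ i + + j * (j ↓ i)                  ≡⟨ cong (_+_ (j ↓ i)) (*-↓ j i) ⟩
  j ↓ i + (j ↓ suc i + + i * (j ↓ i))    ≡⟨ ring₂ (j ↓ i) (j ↓ suc i) (+ i) ⟩
  j ↓ suc i + (+ 1 + + i) * (j ↓ i)      ∎
  where
  ring₁ : ∀ a x → (+ 1 + a) * x ≡ x + a * x
  ring₁ = solve-∀
  ring₂ : ∀ x y a → x + (y + a * x) ≡ y + (+ 1 + a) * x
  ring₂ = solve-∀

-- a is read as the coefficient sequence of ∑ᵢ aᵢ x(x - 1)⋯(x - i + 1), evaluated at naturals.
⟦_⟧ : Seq → Seq
⟦ a ⟧ j = ∑ (suc j) (λ i → a i * j ↓ i)

diag : ℕ → ℤ
diag i = + i - + 1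

T : Op
T = tridiagonal (λ _ → + 1) diag (λ i → + suc i)

⟦T⟧ : ∀ a j → ⟦ T a ⟧ j ≡ + j * ⟦ a ⟧ j - ⟦ a ⟧ (suc j)
⟦T⟧ a j = begin
  ⟦ T a ⟧ j                ≡⟨ ∑-cong (suc j) (λ i → expand (prev a i) (+ i) (a i) (a (suc i)) (j ↓ i)) ⟩
  ∑ (suc j) (λ i → (u i + v i) - (w i + z i))
    ≡⟨ trans (∑-⊝ (suc j) (u ⊕ v) (w ⊕ z)) (cong₂ _-_ (∑-⊕ (suc j) u v) (∑-⊕ (suc j) w z)) ⟩
  (U + V) - (W + Z)        ≡⟨ cong₂ _-_ (sym j*⟦a⟧) (sym ⟦a⟧[j+1]) ⟩
  + j * W - ⟦ a ⟧ (suc j)  ∎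
  where
  u v w z : Seq
  u i = prev a i * j ↓ i
  v i = + i * (a i * j ↓ i)
  w i = a i * j ↓ i
  z i = + suc i * (a (suc i) * j ↓ i)
  U V W Z : ℤ
  U = ∑ (suc j) u
  V = ∑ (suc j) v
  W = ∑ (suc j) w
  Z = ∑ (suc j) z

  expand : ∀ p x a a′ f → (+ 1 * p + (x - + 1) * a - (+ 1 + x) * a′) * f ≡ (p * f + x * (a * f)) - (a * f + (+ 1 + x) * (a′ * f))
  expand = solve-∀

  j*⟦a⟧ : + j * W ≡ U + V
  j*⟦a⟧ = begin
    + j * W                                          ≡⟨ sym (∑-*ˡ (suc j) (+ j) w) ⟩
    ∑ (suc j) (λ i → + j * (a i * j ↓ i))            ≡⟨ ∑-cong (suc j) (λ i → trans (ring (+ j) (a i) (j ↓ i)) (cong (a i *_) (*-↓ j i))) ⟩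
    ∑ (suc j) (λ i → a i * (j ↓ suc i + + i * j ↓ i)) ≡⟨ ∑-cong (suc j) (λ i → ℤP.*-distribˡ-+ (a i) (j ↓ suc i) (+ i * j ↓ i)) ⟩
    ∑ (suc j) (λ i → a i * j ↓ suc i + a i * (+ i * j ↓ i))
      ≡⟨ ∑-⊕ (suc j) (λ i → a i * j ↓ suc i) (λ i → a i * (+ i * j ↓ i)) ⟩
    ∑ (suc j) (u ∘ suc) + ∑ (suc j) (λ i → a i * (+ i * j ↓ i))
      ≡⟨ cong₂ _+_ (∑-shift (suc j) u refl (trans (cong (a j *_) (↓-vanishes j)) (ℤP.*-zeroʳ (a j))))
                   (∑-cong (suc j) (λ i → ring (a i) (+ i) (j ↓ i))) ⟩
    U + V                                            ∎
    where
    ring : ∀ x y f → x * (y * f) ≡ y * (x * f)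
    ring = solve-∀

  ⟦a⟧[j+1] : ⟦ a ⟧ (suc j) ≡ W + Z
  ⟦a⟧[j+1] = begin
    a 0 * + 1 + ∑ (suc j) (λ i → a (suc i) * suc j ↓ suc i)
      ≡⟨ cong (_+_ (a 0 * + 1)) (∑-cong (suc j) (λ i → trans (cong (a (suc i) *_) (↓-suc j i))
                                                          (ring (a (suc i)) (j ↓ suc i) (+ suc i) (j ↓ i)))) ⟩
    a 0 * + 1 + ∑ (suc j) (λ i → w (suc i) + z i)
      ≡⟨ cong (_+_ (a 0 * + 1)) (∑-⊕ (suc j) (w ∘ suc) z) ⟩
    a 0 * + 1 + (∑ (suc j) (w ∘ suc) + Z)
      ≡⟨ cong (λ t → a 0 * + 1 + (t + Z)) (∑-drop-last j (w ∘ suc) (trans (cong (a (suc j) *_) (↓-vanishes j)) (ℤP.*-zeroʳ (a (suc j))))) ⟩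
    a 0 * + 1 + (∑ j (w ∘ suc) + Z)  ≡⟨ sym (ℤP.+-assoc (a 0 * + 1) _ Z) ⟩
    W + Z                             ∎
    where
    ring : ∀ x y b f → x * (y + b * f) ≡ x * y + b * (x * f)
    ring = solve-∀

δ₀ : Seq
δ₀ zero    = + 1
δ₀ (suc _) = + 0

⟦δ₀⟧ : ∀ j → ⟦ δ₀ ⟧ j ≡ + 1
⟦δ₀⟧ j = cong (_+_ (+ 1)) (∑-*ˡ j (+ 0) (λ i → j ↓ suc i))

∑-S-sign : ∀ n a → ∑ (suc n) (λ k → + S n k * (sign k * ⟦ a ⟧ k)) ≡ (T ^[ n ]) a 0
∑-S-sign zero    a = trans (ring (a 0)) (sym (cong-app (^[zero] T a) 0))
  where
  ring : ∀ x → + 1 * (+ 1 * (x * + 1 + + 0)) + + 0 ≡ x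
  ring = solve-∀
∑-S-sign (suc n) a = begin
  ∑ (suc (suc n)) (λ k → + S (suc n) k * (sign k * ⟦ a ⟧ k))
    ≡⟨ ∑-S-suc n (λ k → sign k * ⟦ a ⟧ k) ⟩
  ∑ (suc n) (λ k → + S n k * (+ k * (sign k * ⟦ a ⟧ k) + sign (suc k) * ⟦ a ⟧ (suc k)))
    ≡⟨ ∑-cong (suc n) (λ k → cong (+ S n k *_) (signed-step k)) ⟩
  ∑ (suc n) (λ k → + S n k * (sign k * ⟦ T a ⟧ k))
    ≡⟨ ∑-S-sign n (T a) ⟩
  (T ^[ n ]) (T a) 0
    ≡⟨ sym (cong-app (^[suc] T n a) 0) ⟩
  (T ^[ suc n ]) a 0 ∎
  where
  signed-step : ∀ k → + k * (sign k * ⟦ a ⟧ k) + sign (suc k) * ⟦ a ⟧ (suc k) ≡ sign k * ⟦ T a ⟧ k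
  signed-step k = begin
    + k * (sign k * ⟦ a ⟧ k) + sign (suc k) * ⟦ a ⟧ (suc k)
      ≡⟨ cong (λ s → + k * (sign k * ⟦ a ⟧ k) + s * ⟦ a ⟧ (suc k)) (sign-suc k) ⟩
    + k * (sign k * ⟦ a ⟧ k) + - sign k * ⟦ a ⟧ (suc k)
      ≡⟨ ring (+ k) (sign k) (⟦ a ⟧ k) (⟦ a ⟧ (suc k)) ⟩
    sign k * (+ k * ⟦ a ⟧ k - ⟦ a ⟧ (suc k))
      ≡⟨ cong (sign k *_) (sym (⟦T⟧ a k)) ⟩
    sign k * ⟦ T a ⟧ k ∎
    where
    ring : ∀ x s p q → x * (s * p) + - s * q ≡ s * (x * p - q)
    ring = solve-∀

Bpm≡T^n : ∀ n → Bpm n ≡ (T ^[ n ]) δ₀ 0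
Bpm≡T^n n = begin
  Bpm n                                              ≡⟨ Bpm≡∑ n ⟩
  ∑ (suc n) (λ k → sign k * + S n k)                 ≡⟨ ∑-cong (suc n) sign-S ⟩
  ∑ (suc n) (λ k → + S n k * (sign k * ⟦ δ₀ ⟧ k))    ≡⟨ ∑-S-sign n δ₀ ⟩
  (T ^[ n ]) δ₀ 0                                    ∎
  where
  sign-S : ∀ k → sign k * + S n k ≡ + S n k * (sign k * ⟦ δ₀ ⟧ k)
  sign-S k = begin
    sign k * + S n k              ≡⟨ ℤP.*-comm (sign k) (+ S n k) ⟩
    + S n k * sign k              ≡⟨ cong (+ S n k *_) (sym (ℤP.*-identityʳ (sign k))) ⟩
    + S n k * (sign k * + 1)      ≡⟨ cong (λ t → + S n k * (sign k * t)) (sym (⟦δ₀⟧ k)) ⟩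
    + S n k * (sign k * ⟦ δ₀ ⟧ k) ∎

tridiagonal-similar : ∀ (w l d u l′ u′ : ℕ → ℤ) →
  (∀ i → l (suc i) * w i ≡ w (suc i) * l′ (suc i)) →
  (∀ i → u i * w (suc i) ≡ w i * u′ i) →
  ∀ c → tridiagonal l d u (w ⊙ c) ≗ w ⊙ tridiagonal l′ d u′ c
tridiagonal-similar w l d u l′ u′ lower upper c i = begin
  l i * prev (w ⊙ c) i + d i * (w i * c i) - u i * (w (suc i) * c (suc i))
    ≡⟨ cong₂ (λ p q → p + d i * (w i * c i) - q) (lower′ i) upper′ ⟩
  w i * (l′ i * prev c i) + d i * (w i * c i) - w i * (u′ i * c (suc i))
    ≡⟨ ring (w i) (l′ i * prev c i) (d i) (c i) (u′ i * c (suc i)) ⟩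
  w i * (l′ i * prev c i + d i * c i - u′ i * c (suc i)) ∎
  where
  ring : ∀ w p d a q → w * p + d * (w * a) - w * q ≡ w * (p + d * a - q)
  ring = solve-∀

  lower′ : ∀ i → l i * prev (w ⊙ c) i ≡ w i * (l′ i * prev c i)
  lower′ zero    = trans (ℤP.*-zeroʳ (l 0)) (sym (trans (cong (w 0 *_) (ℤP.*-zeroʳ (l′ 0))) (ℤP.*-zeroʳ (w 0))))
  lower′ (suc i) = begin
    l (suc i) * (w i * c i)            ≡⟨ sym (ℤP.*-assoc (l (suc i)) (w i) (c i)) ⟩
    l (suc i) * w i * c i              ≡⟨ cong (_* c i) (lower i) ⟩
    w (suc i) * l′ (suc i) * c i       ≡⟨ ℤP.*-assoc (w (suc i)) (l′ (suc i)) (c i) ⟩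
    w (suc i) * (l′ (suc i) * c i)     ∎

  upper′ : u i * (w (suc i) * c (suc i)) ≡ w i * (u′ i * c (suc i))
  upper′ = begin
    u i * (w (suc i) * c (suc i))      ≡⟨ sym (ℤP.*-assoc (u i) (w (suc i)) (c (suc i))) ⟩
    u i * w (suc i) * c (suc i)        ≡⟨ cong (_* c (suc i)) (upper i) ⟩
    w i * u′ i * c (suc i)             ≡⟨ ℤP.*-assoc (w i) (u′ i) (c (suc i)) ⟩
    w i * (u′ i * c (suc i))           ∎

^[]-similar : ∀ {A B} (w : Seq) → Linear A → (∀ c → A (w ⊙ c) ≗ w ⊙ B c) →
  ∀ n c → (A ^[ n ]) (w ⊙ c) ≗ w ⊙ (B ^[ n ]) c
^[]-similar {A} {B} w lin-A similar zero    c i =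
  trans (cong-app (^[zero] A (w ⊙ c)) i) (cong (w i *_) (sym (cong-app (^[zero] B c) i)))
^[]-similar {A} {B} w lin-A similar (suc n) c i = begin
  (A ^[ suc n ]) (w ⊙ c) i     ≡⟨ cong-app (^[suc] A n (w ⊙ c)) i ⟩
  (A ^[ n ]) (A (w ⊙ c)) i     ≡⟨ resp-≗ (^[]-linear n lin-A) (similar c) i ⟩
  (A ^[ n ]) (w ⊙ B c) i       ≡⟨ ^[]-similar w lin-A similar n (B c) i ⟩
  w i * (B ^[ n ]) (B c) i     ≡⟨ cong (w i *_) (sym (cong-app (^[suc] B n c) i)) ⟩
  w i * (B ^[ suc n ]) c i     ∎

2^_ : ℕ → ℤ
2^ n = (+ 2) ^ n

weight : ℕ → ℤ
weight i = 2^ ⌊ i /2⌋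

-- M = W T W⁻¹ for W = diag (weight i): subdiag i = weight i / weight (i - 1) and
-- superdiag i = (i + 1) weight i / weight (i + 1).
subdiag superdiag : ℕ → ℤ
subdiag zero          = + 2
subdiag (suc zero)    = + 1
subdiag (suc (suc i)) = subdiag i
superdiag zero          = + 1
superdiag (suc zero)    = + 1
superdiag (suc (suc i)) = superdiag i + subdiag i

M : Op
M = tridiagonal subdiag diag superdiag

subdiag-weight : ∀ i → subdiag (suc i) * weight i ≡ weight (suc i)
subdiag-weight zero          = refl
subdiag-weight (suc zero)    = refl
subdiag-weight (suc (suc i)) = begin
  subdiag (suc i) * (+ 2 * weight i)   ≡⟨ ring (subdiag (suc i)) (weight i) ⟩
  + 2 * (subdiag (suc i) * weight i)   ≡⟨ cong (+ 2 *_) (subdiag-weight i) ⟩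
  + 2 * weight (suc i)                 ∎
  where
  ring : ∀ a b → a * (+ 2 * b) ≡ + 2 * (a * b)
  ring = solve-∀

subdiag-weight-suc : ∀ i → subdiag i * weight (suc i) ≡ + 2 * weight i
subdiag-weight-suc zero          = refl
subdiag-weight-suc (suc zero)    = refl
subdiag-weight-suc (suc (suc i)) = begin
  subdiag i * (+ 2 * weight (suc i))   ≡⟨ ring (subdiag i) (weight (suc i)) ⟩
  + 2 * (subdiag i * weight (suc i))   ≡⟨ cong (+ 2 *_) (subdiag-weight-suc i) ⟩
  + 2 * (+ 2 * weight i)               ∎
  where
  ring : ∀ a b → a * (+ 2 * b) ≡ + 2 * (a * b)
  ring = solve-∀

superdiag-weight : ∀ i → superdiag i * weight (suc i) ≡ weight i * + suc i
superdiag-weight zero          = refl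
superdiag-weight (suc zero)    = refl
superdiag-weight (suc (suc i)) = begin
  (superdiag i + subdiag i) * (+ 2 * weight (suc i))
    ≡⟨ ring₁ (superdiag i) (subdiag i) (weight (suc i)) ⟩
  + 2 * (superdiag i * weight (suc i)) + + 2 * (subdiag i * weight (suc i))
    ≡⟨ cong₂ (λ p q → + 2 * p + + 2 * q) (superdiag-weight i) (subdiag-weight-suc i) ⟩
  + 2 * (weight i * + suc i) + + 2 * (+ 2 * weight i)
    ≡⟨ ring₂ (weight i) (+ i) ⟩
  + 2 * weight i * (+ 3 + + i) ∎
  where
  ring₁ : ∀ a b c → (a + b) * (+ 2 * c) ≡ + 2 * (a * c) + + 2 * (b * c)
  ring₁ = solve-∀
  ring₂ : ∀ w x → + 2 * (w * (+ 1 + x)) + + 2 * (+ 2 * w) ≡ + 2 * w * (+ 3 + x)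
  ring₂ = solve-∀

M-linear : Linear M
M-linear = tridiagonal-linear subdiag diag superdiag

M^n-weight : ∀ n c → (M ^[ n ]) (weight ⊙ c) ≗ weight ⊙ (T ^[ n ]) c
M^n-weight = ^[]-similar weight M-linear
  (tridiagonal-similar weight subdiag diag superdiag (λ _ → + 1) (λ i → + suc i)
    (λ i → trans (subdiag-weight i) (sym (ℤP.*-identityʳ (weight (suc i)))))
    superdiag-weight)

Bpm≡M^n : ∀ n → Bpm n ≡ (M ^[ n ]) δ₀ 0
Bpm≡M^n n = begin
  Bpm n                          ≡⟨ Bpm≡T^n n ⟩
  (T ^[ n ]) δ₀ 0                ≡⟨ sym (ℤP.*-identityˡ _) ⟩
  weight 0 * (T ^[ n ]) δ₀ 0     ≡⟨ sym (M^n-weight n δ₀ 0) ⟩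
  (M ^[ n ]) (weight ⊙ δ₀) 0     ≡⟨ resp-≗ (^[]-linear n M-linear) weight⊙δ₀ 0 ⟩
  (M ^[ n ]) δ₀ 0                ∎
  where
  weight⊙δ₀ : weight ⊙ δ₀ ≗ δ₀
  weight⊙δ₀ zero    = refl
  weight⊙δ₀ (suc i) = ℤP.*-zeroʳ (weight (suc i))

-- Congruences and the certificate M²⁴ ≡ 1 (mod 8)

infix 4 _≡_[mod_] _≋_[mod_] _≡?_[mod_]

record _≡_[mod_] (a b k : ℤ) : Set where
  constructor mod-∣
  field ∣-diff : k ∣ a - b
open _≡_[mod_]

_≋_[mod_] : Seq → Seq → ℤ → Set
c ≋ d [mod k ] = ∀ i → c i ≡ d i [mod k ]

𝟘 : Seq
𝟘 _ = + 0

module _ {k : ℤ} where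

  ≡-mod-reflexive : ∀ {a b} → a ≡ b → a ≡ b [mod k ]
  ≡-mod-reflexive {a} refl = mod-∣ (divides (+ 0) (ℤP.+-inverseʳ a))

  ≡-mod-refl : ∀ {a} → a ≡ a [mod k ]
  ≡-mod-refl = ≡-mod-reflexive refl

  ≡-mod-trans : ∀ {a b c} → a ≡ b [mod k ] → b ≡ c [mod k ] → a ≡ c [mod k ]
  ≡-mod-trans {a} {b} {c} (mod-∣ p) (mod-∣ q) = mod-∣ (subst (k ∣_) (ring a b c) (∣m∣n⇒∣m+n p q))
    where
    ring : ∀ a b c → (a - b) + (b - c) ≡ a - c
    ring = solve-∀

  +-cong-mod : ∀ {a a′ b b′} → a ≡ a′ [mod k ] → b ≡ b′ [mod k ] → a + b ≡ a′ + b′ [mod k ]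
  +-cong-mod {a} {a′} {b} {b′} (mod-∣ p) (mod-∣ q) = mod-∣ (subst (k ∣_) (ring a a′ b b′) (∣m∣n⇒∣m+n p q))
    where
    ring : ∀ a a′ b b′ → (a - a′) + (b - b′) ≡ (a + b) - (a′ + b′)
    ring = solve-∀

  -‿cong-mod : ∀ {a a′} → a ≡ a′ [mod k ] → - a ≡ - a′ [mod k ]
  -‿cong-mod {a} {a′} (mod-∣ p) = mod-∣ (subst (k ∣_) (ring a a′) (∣m⇒∣-m p))
    where
    ring : ∀ a a′ → - (a - a′) ≡ - a - - a′
    ring = solve-∀

  *-cong-mod : ∀ {a a′ b b′} → a ≡ a′ [mod k ] → b ≡ b′ [mod k ] → a * b ≡ a′ * b′ [mod k ]
  *-cong-mod {a} {a′} {b} {b′} (mod-∣ p) (mod-∣ q) =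
    mod-∣ (subst (k ∣_) (ring a a′ b b′) (∣m∣n⇒∣m+n (∣n⇒∣m*n a q) (∣m⇒∣m*n b′ p)))
    where
    ring : ∀ a a′ b b′ → a * (b - b′) + (a - a′) * b′ ≡ a * b - a′ * b′
    ring = solve-∀

  ≡-mod⇒-≡0 : ∀ {a b} → a ≡ b [mod k ] → a - b ≡ + 0 [mod k ]
  ≡-mod⇒-≡0 {a} {b} (mod-∣ p) = mod-∣ (subst (k ∣_) (sym (ℤP.+-identityʳ (a - b))) p)

  -≡0⇒≡-mod : ∀ {a b} → a - b ≡ + 0 [mod k ] → a ≡ b [mod k ]
  -≡0⇒≡-mod {a} {b} (mod-∣ p) = mod-∣ (subst (k ∣_) (ℤP.+-identityʳ (a - b)) p)

  ∣⇒≡0-mod : ∀ {a} → k ∣ a → a ≡ + 0 [mod k ]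
  ∣⇒≡0-mod {a} p = mod-∣ (subst (k ∣_) (sym (ℤP.+-identityʳ a)) p)

  ≡0-mod⇒∣ : ∀ {a} → a ≡ + 0 [mod k ] → k ∣ a
  ≡0-mod⇒∣ {a} (mod-∣ p) = subst (k ∣_) (ℤP.+-identityʳ a) p


_≡?_[mod_] : ∀ a b k → Dec (a ≡ b [mod k ])
a ≡? b [mod k ] = Dec.map′ mod-∣ ∣-diff (k ∣? a - b)

≡-mod-weaken : ∀ {j k a b} → j ∣ k → a ≡ b [mod k ] → a ≡ b [mod j ]
≡-mod-weaken j∣k (mod-∣ p) = mod-∣ (∣-trans j∣k p)

*-cong-modˡ : ∀ j {k a b} → a ≡ b [mod k ] → j * a ≡ j * b [mod j * k ]
*-cong-modˡ j {k} {a} {b} (mod-∣ p) = mod-∣ (subst (j * k ∣_) (ring j a b) (*-monoʳ-∣ j p))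
  where
  ring : ∀ j a b → j * (a - b) ≡ j * a - j * b
  ring = solve-∀

⟪_⟫ : List ℤ → Seq → ℕ → ℤ
⟪ []    ⟫ c p = + 0
⟪ x ∷ L ⟫ c p = x * c p + ⟪ L ⟫ c (suc p)

add₂ : ℤ → ℤ → List ℤ → List ℤ
add₂ a b []          = a ∷ b ∷ []
add₂ a b (x ∷ [])     = a + x ∷ b ∷ []
add₂ a b (x ∷ y ∷ L) = a + x ∷ b + y ∷ L

⟪add₂⟫ : ∀ a b L c p → ⟪ add₂ a b L ⟫ c p ≡ a * c p + (b * c (suc p) + ⟪ L ⟫ c p)
⟪add₂⟫ a b []          c p = refl
⟪add₂⟫ a b (x ∷ [])     c p = ring a b x (c p) (c (suc p))
  where
  ring : ∀ a b x u v → (a + x) * u + (b * v + + 0) ≡ a * u + (b * v + (x * u + + 0))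
  ring = solve-∀
⟪add₂⟫ a b (x ∷ y ∷ L) c p = ring a b x y (c p) (c (suc p)) (⟪ L ⟫ c (suc (suc p)))
  where
  ring : ∀ a b x y u v e → (a + x) * u + ((b + y) * v + e) ≡ a * u + (b * v + (x * u + (y * v + e)))
  ring = solve-∀

⟪unit-vector⟫ : ∀ i p c → ⟪ replicate i (+ 0) ++ + 1 ∷ [] ⟫ c p ≡ c (i ℕ.+ p)
⟪unit-vector⟫ zero    p c = trans (ℤP.+-identityʳ _) (ℤP.*-identityˡ (c p))
⟪unit-vector⟫ (suc i) p c = trans (ℤP.+-identityˡ _) (trans (⟪unit-vector⟫ i (suc p) c) (cong c (ℕP.+-suc i p)))

_≈_[mod_] : List ℤ → List ℤ → ℤ → Set
L ≈ L′ [mod k ] = Pointwise (λ a b → a ≡ b [mod k ]) L L′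

module _ {k : ℤ} where

  ⟪⟫-cong-mod : ∀ {L L′} → L ≈ L′ [mod k ] → ∀ c p → ⟪ L ⟫ c p ≡ ⟪ L′ ⟫ c p [mod k ]
  ⟪⟫-cong-mod []         c p = ≡-mod-refl
  ⟪⟫-cong-mod (x≡y ∷ L≈L′) c p = +-cong-mod (*-cong-mod x≡y ≡-mod-refl) (⟪⟫-cong-mod L≈L′ c (suc p))

  add₂-cong-mod : ∀ {a a′ b b′ L L′} → a ≡ a′ [mod k ] → b ≡ b′ [mod k ] → L ≈ L′ [mod k ] →
    add₂ a b L ≈ add₂ a′ b′ L′ [mod k ]
  add₂-cong-mod a≡ b≡ []                = a≡ ∷ b≡ ∷ []
  add₂-cong-mod a≡ b≡ (x≡ ∷ [])          = +-cong-mod a≡ x≡ ∷ b≡ ∷ []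
  add₂-cong-mod a≡ b≡ (x≡ ∷ y≡ ∷ L≈L′) = +-cong-mod a≡ x≡ ∷ +-cong-mod b≡ y≡ ∷ L≈L′

UnitAt : ℤ → ℕ → List ℤ → Set
UnitAt k _         []      = ⊥
UnitAt k zero      (x ∷ L) = x ≡ + 1 [mod k ] × All (λ y → y ≡ + 0 [mod k ]) L
UnitAt k (suc pos) (x ∷ L) = x ≡ + 0 [mod k ] × UnitAt k pos L

unitAt? : ∀ k pos L → Dec (UnitAt k pos L)
unitAt? k pos       []      = no λ ()
unitAt? k zero      (x ∷ L) = (x ≡? + 1 [mod k ]) ×-dec All.all? (λ y → y ≡? + 0 [mod k ]) L
unitAt? k (suc pos) (x ∷ L) = (x ≡? + 0 [mod k ]) ×-dec unitAt? k pos L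

module _ {k : ℤ} where

  ⟪⟫-zeros : ∀ {L} → All (λ y → y ≡ + 0 [mod k ]) L → ∀ c p → ⟪ L ⟫ c p ≡ + 0 [mod k ]
  ⟪⟫-zeros []         c p = ≡-mod-refl
  ⟪⟫-zeros (x≡0 ∷ L≡0) c p = +-cong-mod (*-cong-mod x≡0 ≡-mod-refl) (⟪⟫-zeros L≡0 c (suc p))

  ⟪⟫-unit : ∀ pos {L} → UnitAt k pos L → ∀ c p → ⟪ L ⟫ c p ≡ c (pos ℕ.+ p) [mod k ]
  ⟪⟫-unit zero {x ∷ L} (x≡1 , L≡0) c p =
    ≡-mod-trans (+-cong-mod (*-cong-mod x≡1 ≡-mod-refl) (⟪⟫-zeros L≡0 c (suc p)))
                (≡-mod-reflexive (trans (ℤP.+-identityʳ _) (ℤP.*-identityˡ (c p))))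
  ⟪⟫-unit (suc pos) {x ∷ L} (x≡0 , unit) c p =
    ≡-mod-trans (+-cong-mod (*-cong-mod x≡0 ≡-mod-refl) (⟪⟫-unit pos unit c (suc p)))
                (≡-mod-reflexive (trans (ℤP.+-identityˡ _) (cong c (ℕP.+-suc pos p))))

Periodic : ℤ → ℕ → (ℕ → ℤ) → Set
Periodic k P f = ∀ i → f (i ℕ.+ P) ≡ f i [mod k ]

module TridiagonalForms (l d u : ℕ → ℤ) where

  A : Op
  A = tridiagonal l d u

  pull : List ℤ → ℕ → List ℤ
  pull []      p = []
  pull (x ∷ L) p = x * l (suc p) ∷ add₂ (x * d (suc p)) (- (x * u (suc p))) (pull L (suc p))

  pull₀ : List ℤ → List ℤ
  pull₀ []      = []
  pull₀ (x ∷ L) = add₂ (x * d 0) (- (x * u 0)) (pull L 0)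

  ⟪pull⟫ : ∀ L p c → ⟪ L ⟫ (A c) (suc p) ≡ ⟪ pull L p ⟫ c p
  ⟪pull⟫ []      p c = refl
  ⟪pull⟫ (x ∷ L) p c = begin
    x * A c (suc p) + ⟪ L ⟫ (A c) (suc (suc p))
      ≡⟨ cong (_+_ (x * A c (suc p))) (⟪pull⟫ L (suc p) c) ⟩
    x * A c (suc p) + ⟪ pull L (suc p) ⟫ c (suc p)
      ≡⟨ ring x (l (suc p)) (d (suc p)) (u (suc p)) (c p) (c (suc p)) (c (suc (suc p))) _ ⟩
    x * l (suc p) * c p + (x * d (suc p) * c (suc p) + (- (x * u (suc p)) * c (suc (suc p)) + ⟪ pull L (suc p) ⟫ c (suc p)))
      ≡⟨ cong (_+_ (x * l (suc p) * c p)) (sym (⟪add₂⟫ (x * d (suc p)) (- (x * u (suc p))) (pull L (suc p)) c (suc p))) ⟩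
    ⟪ pull (x ∷ L) p ⟫ c p ∎
    where
    ring : ∀ x l d u a b e r → x * (l * a + d * b - u * e) + r ≡ x * l * a + (x * d * b + (- (x * u) * e + r))
    ring = solve-∀

  ⟪pull₀⟫ : ∀ L c → ⟪ L ⟫ (A c) 0 ≡ ⟪ pull₀ L ⟫ c 0
  ⟪pull₀⟫ []      c = refl
  ⟪pull₀⟫ (x ∷ L) c = begin
    x * A c 0 + ⟪ L ⟫ (A c) 1                         ≡⟨ cong (_+_ (x * A c 0)) (⟪pull⟫ L 0 c) ⟩
    x * A c 0 + ⟪ pull L 0 ⟫ c 0                      ≡⟨ ring x (l 0) (d 0) (u 0) (c 0) (c 1) _ ⟩
    x * d 0 * c 0 + (- (x * u 0) * c 1 + ⟪ pull L 0 ⟫ c 0)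
      ≡⟨ sym (⟪add₂⟫ (x * d 0) (- (x * u 0)) (pull L 0) c 0) ⟩
    ⟪ pull₀ (x ∷ L) ⟫ c 0                             ∎
    where
    ring : ∀ x l d u b e r → x * (l * + 0 + d * b - u * e) + r ≡ x * d * b + (- (x * u) * e + r)
    ring = solve-∀

  form₀ : ℕ → ℕ → List ℤ
  form₀ zero    i = replicate i (+ 0) ++ + 1 ∷ []
  form₀ (suc n) i = pull₀ (form₀ n i)

  form : ℕ → ℕ → List ℤ
  form zero    b = + 1 ∷ []
  form (suc n) b = pull (form n (suc b)) b

  form₀-correct : ∀ n i c → (A ^[ n ]) c i ≡ ⟪ form₀ n i ⟫ c 0
  form₀-correct zero    i c = trans (cong-app (^[zero] A c) i) (sym (trans (⟪unit-vector⟫ i 0 c) (cong c (ℕP.+-identityʳ i))))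
  form₀-correct (suc n) i c = begin
    (A ^[ suc n ]) c i             ≡⟨ cong-app (^[suc] A n c) i ⟩
    (A ^[ n ]) (A c) i             ≡⟨ form₀-correct n i (A c) ⟩
    ⟪ form₀ n i ⟫ (A c) 0          ≡⟨ ⟪pull₀⟫ (form₀ n i) c ⟩
    ⟪ form₀ (suc n) i ⟫ c 0        ∎

  form-correct : ∀ n b c → (A ^[ n ]) c (n ℕ.+ b) ≡ ⟪ form n b ⟫ c b
  form-correct zero    b c = trans (cong-app (^[zero] A c) b) (sym (trans (ℤP.+-identityʳ _) (ℤP.*-identityˡ (c b))))
  form-correct (suc n) b c = begin
    (A ^[ suc n ]) c (suc n ℕ.+ b)    ≡⟨ cong-app (^[suc] A n c) _ ⟩
    (A ^[ n ]) (A c) (suc (n ℕ.+ b))  ≡⟨ cong ((A ^[ n ]) (A c)) (sym (ℕP.+-suc n b)) ⟩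
    (A ^[ n ]) (A c) (n ℕ.+ suc b)    ≡⟨ form-correct n (suc b) (A c) ⟩
    ⟪ form n (suc b) ⟫ (A c) (suc b)  ≡⟨ ⟪pull⟫ (form n (suc b)) b c ⟩
    ⟪ form (suc n) b ⟫ c b            ∎

  module _ {k : ℤ} {P : ℕ} (l-per : Periodic k P l) (d-per : Periodic k P d) (u-per : Periodic k P u) where

    pull-periodic : ∀ {L L′} p → L ≈ L′ [mod k ] → pull L (p ℕ.+ P) ≈ pull L′ p [mod k ]
    pull-periodic p []            = []
    pull-periodic p (x≡y ∷ L≈L′) =
      *-cong-mod x≡y (l-per (suc p)) ∷
      add₂-cong-mod (*-cong-mod x≡y (d-per (suc p))) (-‿cong-mod (*-cong-mod x≡y (u-per (suc p))))
                    (pull-periodic (suc p) L≈L′)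

    form-periodic : ∀ n b → form n (b ℕ.+ P) ≈ form n b [mod k ]
    form-periodic zero    b = ≡-mod-refl ∷ []
    form-periodic (suc n) b = pull-periodic b (form-periodic n (suc b))

    form-periodic* : ∀ n r t → form n (r ℕ.+ t ℕ.* P) ≈ form n r [mod k ]
    form-periodic* n r zero    = subst (λ b → form n b ≈ form n r [mod k ]) (sym (ℕP.+-identityʳ r))
                                   (Pointwise.refl ≡-mod-refl)
    form-periodic* n r (suc t) = subst (λ b → form n b ≈ form n r [mod k ]) (shift r t)
                                   (Pointwise.transitive ≡-mod-trans (form-periodic n (r ℕ.+ t ℕ.* P)) (form-periodic* n r t))
      where
      shift : ∀ r t → r ℕ.+ t ℕ.* P ℕ.+ P ≡ r ℕ.+ suc t ℕ.* P
      shift r t = trans (ℕP.+-assoc r (t ℕ.* P) P) (cong (r ℕ.+_) (ℕP.+-comm (t ℕ.* P) P))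

    -- Near the boundary (i < n) every entry is checked; further out the form of (Aⁿ c) (n + b)
    -- depends on b only modulo the period, so P checks suffice.
    ^[]≡id-by-forms : ∀ n .{{_ : NonZero P}} →
      (∀ (i : Fin n) → UnitAt k (toℕ i) (form₀ n (toℕ i))) →
      (∀ (r : Fin P) → UnitAt k n (form n (toℕ r))) →
      ∀ c → (A ^[ n ]) c ≋ c [mod k ]
    ^[]≡id-by-forms n boundary interior c i with i ℕ.<? n
    ... | yes i<n = subst (λ j → (A ^[ n ]) c j ≡ c j [mod k ]) (FinP.toℕ-fromℕ< i<n) near
      where
      j = fromℕ< i<n
      near : (A ^[ n ]) c (toℕ j) ≡ c (toℕ j) [mod k ]
      near = subst₂ (λ a b → a ≡ c b [mod k ]) (sym (form₀-correct n (toℕ j) c)) (ℕP.+-identityʳ (toℕ j))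
                    (⟪⟫-unit (toℕ j) (boundary j) c 0)
    ... | no i≮n = subst (λ j → (A ^[ n ]) c j ≡ c j [mod k ]) (ℕP.m+[n∸m]≡n (ℕP.≮⇒≥ i≮n)) far
      where
      b = i ℕ.∸ n
      r = fromℕ< (m%n<n b P)
      b≡ : b ≡ toℕ r ℕ.+ (b / P) ℕ.* P
      b≡ = trans (m≡m%n+[m/n]*n b P) (cong (ℕ._+ (b / P) ℕ.* P) (sym (FinP.toℕ-fromℕ< (m%n<n b P))))
      far : (A ^[ n ]) c (n ℕ.+ b) ≡ c (n ℕ.+ b) [mod k ]
      far = subst (λ a → a ≡ c (n ℕ.+ b) [mod k ]) (sym (form-correct n b c))
              (≡-mod-trans (⟪⟫-cong-mod (subst (λ b′ → form n b′ ≈ form n (toℕ r) [mod k ]) (sym b≡) (form-periodic* n (toℕ r) (b / P))) c b)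
                           (⟪⟫-unit n (interior r) c b))

subdiag-periodic : Periodic (+ 8) 16 subdiag
subdiag-periodic zero          = ≡-mod-refl
subdiag-periodic (suc zero)    = ≡-mod-refl
subdiag-periodic (suc (suc i)) = subdiag-periodic i

superdiag-periodic : Periodic (+ 8) 16 superdiag
superdiag-periodic zero          = mod-∣ (divides (+ 2) refl)
superdiag-periodic (suc zero)    = mod-∣ (divides (+ 1) refl)
superdiag-periodic (suc (suc i)) = +-cong-mod (superdiag-periodic i) (subdiag-periodic i)

diag-periodic : Periodic (+ 8) 16 diag
diag-periodic i = mod-∣ (divides (+ 2) (trans (cong (λ t → (t - + 1) - (+ i - + 1)) (ℤP.pos-+ i 16)) (ring (+ i))))
  where
  ring : ∀ x → (x + + 16 - + 1) - (x - + 1) ≡ + 2 * + 8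
  ring = solve-∀

module MForms = TridiagonalForms subdiag diag superdiag

M^24≡id : ∀ c → (M ^[ 24 ]) c ≋ c [mod + 8 ]
M^24≡id = MForms.^[]≡id-by-forms subdiag-periodic diag-periodic superdiag-periodic 24
  (Dec.from-yes (FinP.all? {n = 24} λ i → unitAt? (+ 8) (toℕ i) (MForms.form₀ 24 (toℕ i))))
  (Dec.from-yes (FinP.all? {n = 16} λ r → unitAt? (+ 8) 24 (MForms.form 24 (toℕ r))))

-- Powers of M modulo powers of 2

≡-id-iterate : ∀ {A k} → (∀ c → A c ≋ c [mod k ]) → ∀ t c → (A ^[ t ]) c ≋ c [mod k ]
≡-id-iterate {A} A≡id zero    c i = ≡-mod-reflexive (cong-app (^[zero] A c) i)
≡-id-iterate {A} A≡id (suc t) c i =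
  ≡-mod-trans (≡-mod-reflexive (cong-app (^[suc] A t c) i)) (≡-mod-trans (≡-id-iterate A≡id t (A c) i) (A≡id c i))

linear-lift : ∀ {A j k} → Linear A → (∀ z → A z ≋ 𝟘 [mod j ]) → ∀ {c} → c ≋ 𝟘 [mod k ] → A c ≋ 𝟘 [mod k * j ]
linear-lift {A} {j} {k} lin-A A≡0 {c} c≡0 i = ∣⇒≡0-mod (divides r (begin
  A c i         ≡⟨ resp-≗ lin-A c≗k·q i ⟩
  A (k · q) i   ≡⟨ homogeneous lin-A k q i ⟩
  k * A q i     ≡⟨ cong (k *_) (_∣_.equality j∣Aq) ⟩
  k * (r * j)   ≡⟨ ring k r j ⟩
  r * (k * j)   ∎))
  where
  q : Seq
  q i = _∣_.quotient (≡0-mod⇒∣ (c≡0 i))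
  c≗k·q : c ≗ k · q
  c≗k·q i = trans (_∣_.equality (≡0-mod⇒∣ (c≡0 i))) (ℤP.*-comm (q i) k)
  j∣Aq : j ∣ A q i
  j∣Aq = ≡0-mod⇒∣ (A≡0 q i)
  r : ℤ
  r = _∣_.quotient j∣Aq
  ring : ∀ k r j → k * (r * j) ≡ r * (k * j)
  ring = solve-∀

linear-lift₂ : ∀ {A j k} → Linear A → (∀ z → A z ≋ 𝟘 [mod j ]) →
  ∀ {c c′} → c ≋ c′ [mod k ] → A c ≋ A c′ [mod k * j ]
linear-lift₂ lin-A A≡0 {c} {c′} c≡c′ i = -≡0⇒≡-mod
  (≡-mod-trans (≡-mod-reflexive (sym (subtractive lin-A c c′ i))) (linear-lift lin-A A≡0 (≡-mod⇒-≡0 ∘ c≡c′) i))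

second-difference : ∀ {A} → Linear A → ∀ c i → (A −id) ((A −id) c) i ≡ (A (A c) i - A c i) - (A c i - c i)
second-difference {A} lin-A c i = cong (_- (A c i - c i)) (subtractive lin-A (A c) c i)

square-−id : ∀ {A} → Linear A → ∀ c i → A (A c) i - c i ≡ ((A −id) c i + (A −id) c i) + (A −id) ((A −id) c) i
square-−id {A} lin-A c i = begin
  A (A c) i - c i                             ≡⟨ ring (A (A c) i) (A c i) (c i) ⟩
  D + D + ((A (A c) i - A c i) - (A c i - c i)) ≡⟨ cong (_+_ (D + D)) (sym (second-difference lin-A c i)) ⟩
  D + D + (A −id) ((A −id) c) i               ∎
  where
  D = (A −id) c i
  ring : ∀ x y z → x - z ≡ ((y - z) + (y - z)) + ((x - y) - (y - z))
  ring = solve-∀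

-- Squaring: A² − 1 = 2 (A − 1) + (A − 1)².
square-≡-id : ∀ {A} a → Linear A → (∀ c → A c ≋ c [mod 2^ suc a ]) → ∀ c → A (A c) ≋ c [mod 2^ suc (suc a) ]
square-≡-id {A} a lin-A A≡id c i =
  -≡0⇒≡-mod (subst (λ t → t ≡ + 0 [mod 2^ suc (suc a) ]) (sym (square-−id lin-A c i)) (+-cong-mod doubled squared))
  where
  D≡0 : ∀ z → (A −id) z ≋ 𝟘 [mod 2^ suc a ]
  D≡0 z i = ≡-mod⇒-≡0 (A≡id z i)

  doubled : (A −id) c i + (A −id) c i ≡ + 0 [mod 2^ suc (suc a) ]
  doubled = ≡-mod-trans (≡-mod-reflexive (ring₁ ((A −id) c i))) (*-cong-modˡ (+ 2) (D≡0 c i))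
    where
    ring₁ : ∀ x → x + x ≡ + 2 * x
    ring₁ = solve-∀

  squared : (A −id) ((A −id) c) i ≡ + 0 [mod 2^ suc (suc a) ]
  squared = ≡-mod-weaken (divides (2^ a) (ring₂ (2^ a))) (linear-lift (−id-linear lin-A) D≡0 (D≡0 c) i)
    where
    ring₂ : ∀ x → (+ 2 * x) * (+ 2 * x) ≡ x * (+ 2 * (+ 2 * x))
    ring₂ = solve-∀

E : ℕ → Op
E m = M ^[ 24 ℕ.* 2 ℕ.^ m ]

E-linear : ∀ m → Linear (E m)
E-linear m = ^[]-linear (24 ℕ.* 2 ℕ.^ m) M-linear

E-suc : ∀ m c → E (suc m) c ≡ E m (E m c)
E-suc m c = trans (cong (λ n → (M ^[ n ]) c) (double (2 ℕ.^ m))) (^[+] M _ _ c)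
  where
  double : ∀ x → 24 ℕ.* (2 ℕ.* x) ≡ 24 ℕ.* x ℕ.+ 24 ℕ.* x
  double = ℕ-Solver.solve-∀

E≡id : ∀ m c → E m c ≋ c [mod 2^ (3 ℕ.+ m) ]
E≡id zero    = M^24≡id
E≡id (suc m) c i = subst (λ e → e i ≡ c i [mod 2^ (4 ℕ.+ m) ]) (sym (E-suc m c))
                         (square-≡-id (2 ℕ.+ m) (E-linear m) (E≡id m) c i)

-- Equal to Bpm n by Bpm≡M^n and M^n-δ₀, but computed in polynomial time.
Bpm-fast : ℕ → ℤ
Bpm-fast n = ⟪ MForms.form₀ n 0 ⟫ δ₀ 0

M^n-δ₀ : ∀ n → (M ^[ n ]) δ₀ 0 ≡ Bpm-fast n
M^n-δ₀ n = MForms.form₀-correct n 0 δ₀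

E₀-M^14 : E 0 ((M ^[ 14 ]) δ₀) 0 ≡ Bpm-fast 38
E₀-M^14 = trans (cong-app (sym (^[+] M 14 24 δ₀)) 0) (M^n-δ₀ 38)

E₀²-M^14 : E 0 (E 0 ((M ^[ 14 ]) δ₀)) 0 ≡ Bpm-fast 62
E₀²-M^14 = begin
  E 0 (E 0 ((M ^[ 14 ]) δ₀)) 0   ≡⟨ cong (λ c → E 0 c 0) (sym (^[+] M 14 24 δ₀)) ⟩
  E 0 ((M ^[ 38 ]) δ₀) 0         ≡⟨ cong-app (sym (^[+] M 38 24 δ₀)) 0 ⟩
  (M ^[ 62 ]) δ₀ 0               ≡⟨ M^n-δ₀ 62 ⟩
  Bpm-fast 62                    ∎

orbit : ℕ → Seq
orbit t = (M ^[ 24 ℕ.* t ℕ.+ 14 ]) δ₀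

orbit≡ : ∀ t → orbit t ≡ (M ^[ 14 ]) (((M ^[ 24 ]) ^[ t ]) δ₀)
orbit≡ t = trans (^[+] M (24 ℕ.* t) 14 δ₀)
                 (cong (M ^[ 14 ]) (trans (cong (λ n → (M ^[ n ]) δ₀) (ℕP.*-comm 24 t)) (^[*] M 24 t δ₀)))

E-orbit : ∀ m t → E m (orbit t) ≡ orbit (2 ℕ.^ m ℕ.+ t)
E-orbit m t = trans (sym (^[+] M (24 ℕ.* t ℕ.+ 14) (24 ℕ.* 2 ℕ.^ m) δ₀))
                    (cong (λ n → (M ^[ n ]) δ₀) (shift (2 ℕ.^ m) t))
  where
  shift : ∀ x t → 24 ℕ.* t ℕ.+ 14 ℕ.+ 24 ℕ.* x ≡ 24 ℕ.* (x ℕ.+ t) ℕ.+ 14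
  shift = ℕ-Solver.solve-∀

E₀−id≡0 : ∀ z → (E 0 −id) z ≋ 𝟘 [mod + 8 ]
E₀−id≡0 z i = ≡-mod⇒-≡0 (E≡id 0 z i)

E₀−id-linear : Linear (E 0 −id)
E₀−id-linear = −id-linear (E-linear 0)

E₀−id-M^14 : (E 0 −id) ((M ^[ 14 ]) δ₀) 0 ≡ Bpm-fast 38 - Bpm-fast 14
E₀−id-M^14 = cong₂ _-_ E₀-M^14 (M^n-δ₀ 14)

E₀−id²-M^14 : (E 0 −id) ((E 0 −id) ((M ^[ 14 ]) δ₀)) 0 ≡ (Bpm-fast 62 - Bpm-fast 38) - (Bpm-fast 38 - Bpm-fast 14)
E₀−id²-M^14 = begin
  (E 0 −id) ((E 0 −id) c) 0              ≡⟨ second-difference (E-linear 0) c 0 ⟩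
  (E 0 (E 0 c) 0 - E 0 c 0) - (E 0 c 0 - c 0)
    ≡⟨ cong₂ (λ a b → (a - b) - (b - c 0)) E₀²-M^14 E₀-M^14 ⟩
  (Bpm-fast 62 - Bpm-fast 38) - (Bpm-fast 38 - c 0)
    ≡⟨ cong (λ a → (Bpm-fast 62 - Bpm-fast 38) - (Bpm-fast 38 - a)) (M^n-δ₀ 14) ⟩
  (Bpm-fast 62 - Bpm-fast 38) - (Bpm-fast 38 - Bpm-fast 14) ∎
  where
  c = (M ^[ 14 ]) δ₀

-- Modulo 2⁶ (resp. 2⁹) the first (second) difference of E₀ along the orbit does not depend on t,
-- since orbit t = M¹⁴ c with c ≡ δ₀ (mod 8); its value is read off at t = 0.
E₀−id-orbit : ∀ t → (E 0 −id) (orbit t) 0 ≡ 2^ 5 [mod 2^ 6 ]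
E₀−id-orbit t = subst (λ c → (E 0 −id) c 0 ≡ 2^ 5 [mod 2^ 6 ]) (sym (orbit≡ t))
  (≡-mod-trans (linear-lift₂ (∘-linear E₀−id-linear (^[]-linear 14 M-linear)) (λ z → E₀−id≡0 ((M ^[ 14 ]) z))
                             (≡-id-iterate M^24≡id t δ₀) 0)
               (subst (λ a → a ≡ 2^ 5 [mod 2^ 6 ]) (sym E₀−id-M^14)
                      (Dec.from-yes (Bpm-fast 38 - Bpm-fast 14 ≡? 2^ 5 [mod 2^ 6 ]))))

E₀−id²-orbit : ∀ t → (E 0 −id) ((E 0 −id) (orbit t)) 0 ≡ + 0 [mod 2^ 7 ]
E₀−id²-orbit t = subst (λ c → (E 0 −id) ((E 0 −id) c) 0 ≡ + 0 [mod 2^ 7 ]) (sym (orbit≡ t))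
  (≡-mod-trans (≡-mod-weaken (divides (+ 4) refl) (linear-lift₂ A-linear A≡0 (≡-id-iterate M^24≡id t δ₀) 0))
               (subst (λ a → a ≡ + 0 [mod 2^ 7 ]) (sym E₀−id²-M^14)
                      (Dec.from-yes ((Bpm-fast 62 - Bpm-fast 38) - (Bpm-fast 38 - Bpm-fast 14) ≡? + 0 [mod 2^ 7 ]))))
  where
  A : Op
  A c = (E 0 −id) ((E 0 −id) ((M ^[ 14 ]) c))
  A-linear : Linear A
  A-linear = ∘-linear E₀−id-linear (∘-linear E₀−id-linear (^[]-linear 14 M-linear))
  A≡0 : ∀ z → A z ≋ 𝟘 [mod + 8 * + 8 ]
  A≡0 z = linear-lift E₀−id-linear E₀−id≡0 (E₀−id≡0 ((M ^[ 14 ]) z))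

E−id²-orbit : ∀ m t → (E m −id) ((E m −id) (orbit t)) 0 ≡ + 0 [mod 2^ (7 ℕ.+ m) ]
E−id²-orbit zero    t = E₀−id²-orbit t
E−id²-orbit (suc m) t = ≡-mod-weaken (divides (2^ m) (ring (2^ m)))
  (linear-lift (−id-linear (E-linear (suc m))) D≡0 (D≡0 (orbit t)) 0)
  where
  D≡0 : ∀ z → (E (suc m) −id) z ≋ 𝟘 [mod 2^ (4 ℕ.+ m) ]
  D≡0 z i = ≡-mod⇒-≡0 (E≡id (suc m) z i)
  ring : ∀ x → (+ 2 * (+ 2 * (+ 2 * (+ 2 * x))))  * (+ 2 * (+ 2 * (+ 2 * (+ 2 * x))))
             ≡ x * (+ 2 * (+ 2 * (+ 2 * (+ 2 * (+ 2 * (+ 2 * (+ 2 * (+ 2 * x))))))))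
  ring = solve-∀

E−id-orbit : ∀ m t → (E m −id) (orbit t) 0 ≡ 2^ (5 ℕ.+ m) [mod 2^ (6 ℕ.+ m) ]
E−id-orbit zero    t = E₀−id-orbit t
E−id-orbit (suc m) t = subst (λ a → a ≡ 2^ (6 ℕ.+ m) [mod 2^ (7 ℕ.+ m) ]) (sym expand)
  (subst (λ a → D + D + (E m −id) ((E m −id) v) 0 ≡ a [mod 2^ (7 ℕ.+ m) ]) (ℤP.+-identityʳ _)
    (+-cong-mod doubled (E−id²-orbit m t)))
  where
  v = orbit t
  D = (E m −id) v 0
  expand : (E (suc m) −id) v 0 ≡ D + D + (E m −id) ((E m −id) v) 0
  expand = trans (cong (λ c → c 0 - v 0) (E-suc m v)) (square-−id (E-linear m) v 0)
  doubled : D + D ≡ 2^ (6 ℕ.+ m) [mod 2^ (7 ℕ.+ m) ]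
  doubled = ≡-mod-trans (≡-mod-reflexive (ring D)) (*-cong-modˡ (+ 2) (E−id-orbit m t))
    where
    ring : ∀ x → x + x ≡ + 2 * x
    ring = solve-∀

-- The 2-adic valuation and the sequence x_m

ν₂ℕ-fuel-spec : ∀ f n → suc n ℕ.≤ f → ∀ k → k ℕ.≤ ν₂ℕ-fuel f (suc n) ⇔ 2 ℕ.^ k ℕ∣.∣ suc n
ν₂ℕ-fuel-spec (suc f) n n<f k with suc n ℕ.% 2 in parity
... | zero  = halve (suc n ℕ./ 2) (trans (m≡m%n+[m/n]*n (suc n) 2) (cong (ℕ._+ (suc n ℕ./ 2) ℕ.* 2) parity)) k
  where
  halve : ∀ h → suc n ≡ h ℕ.* 2 → ∀ k → k ℕ.≤ suc (ν₂ℕ-fuel f h) ⇔ 2 ℕ.^ k ℕ∣.∣ suc n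
  halve (suc h) n≡2h zero    = mk⇔ (λ _ → ℕ∣.1∣ _) (λ _ → ℕ.z≤n)
  halve (suc h) n≡2h (suc k) = mk⇔
    (λ { (ℕ.s≤s k≤ν) → subst (2 ℕ.^ suc k ℕ∣.∣_) (trans (ℕP.*-comm 2 (suc h)) (sym n≡2h))
                               (ℕ∣.*-monoʳ-∣ 2 (Equivalence.to IH k≤ν)) })
    (λ d → ℕ.s≤s (Equivalence.from IH (ℕ∣.*-cancelˡ-∣ 2 (subst (2 ℕ.^ suc k ℕ∣.∣_) (trans n≡2h (ℕP.*-comm (suc h) 2)) d))))
    where
    h<f : suc h ℕ.≤ f
    h<f = ℕP.≤-trans (subst (suc h ℕ.≤_) (sym (ℕP.suc-injective n≡2h)) (ℕ.s≤s (ℕP.m≤m*n h 2))) (ℕP.≤-pred n<f)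
    IH = ν₂ℕ-fuel-spec f h h<f k
... | suc _ = mk⇔ (λ { ℕ.z≤n → ℕ∣.1∣ _ }) (odd k)
  where
  odd : ∀ k → 2 ℕ.^ k ℕ∣.∣ suc n → k ℕ.≤ 0
  odd zero    _ = ℕ.z≤n
  odd (suc k) d with () ← trans (sym (ℕ∣.n∣m⇒m%n≡0 (suc n) 2 (ℕ∣.∣-trans (ℕ∣.divides (2 ℕ.^ k) (ℕP.*-comm 2 (2 ℕ.^ k))) d))) parity

∣2^k∣ : ∀ k → ∣ 2^ k ∣ ≡ 2 ℕ.^ k
∣2^k∣ zero    = refl
∣2^k∣ (suc k) = trans (ℤP.abs-* (+ 2) (2^ k)) (cong (2 ℕ.*_) (∣2^k∣ k))

≤∞-ν₂ : ∀ z k → k ≤∞ ν₂ z ⇔ 2^ k ∣ z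
≤∞-ν₂ z k with ∣ z ∣ in ∣z∣≡
... | zero  = mk⇔ (λ _ → divides (+ 0) (ℤP.∣i∣≡0⇒i≡0 ∣z∣≡)) (λ _ → tt)
... | suc n = mk⇔
  (λ k≤ν → ∣ᵤ⇒∣ (subst₂ ℕ∣._∣_ (sym (∣2^k∣ k)) (sym ∣z∣≡) (Equivalence.to spec k≤ν)))
  (λ d → Equivalence.from spec (subst₂ ℕ∣._∣_ (∣2^k∣ k) ∣z∣≡ (∣⇒∣ᵤ d)))
  where
  spec = ν₂ℕ-fuel-spec (suc n) n ℕP.≤-refl k

<∞?-true : ∀ k v → (k <∞? v) ≡ true → k <∞ v
<∞?-true k (fin n) k<?n = ℕP.<ᵇ⇒< k n (subst Bool.T (sym k<?n) tt)
<∞?-true k ∞       _    = tt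

<∞?-false : ∀ k v → (k <∞? v) ≡ false → ¬ k <∞ v
<∞?-false k (fin n) k≮?n k<n = subst Bool.T k≮?n (ℕP.<⇒<ᵇ k<n)

odd-multiple : ∀ k z → k ∣ z → ¬ (+ 2 * k ∣ z) → z ≡ k [mod + 2 * k ]
odd-multiple k z (divides q z≡qk) 2k∤z with q %ℕ 2 | a≡a%ℕn+[a/ℕn]*n q 2 | n%ℕd<d q 2
... | zero        | q≡ | _ = ⊥-elim (2k∤z (divides (q /ℕ 2) (begin
  z                          ≡⟨ z≡qk ⟩
  q * k                      ≡⟨ cong (_* k) q≡ ⟩
  (+ 0 + q /ℕ 2 * + 2) * k   ≡⟨ ring (q /ℕ 2) k ⟩
  q /ℕ 2 * (+ 2 * k)         ∎)))
  where
  ring : ∀ h k → (+ 0 + h * + 2) * k ≡ h * (+ 2 * k)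
  ring = solve-∀
... | suc zero    | q≡ | _ = mod-∣ (divides (q /ℕ 2) (begin
  z - k                      ≡⟨ cong (_- k) z≡qk ⟩
  q * k - k                  ≡⟨ cong (λ q′ → q′ * k - k) q≡ ⟩
  (+ 1 + q /ℕ 2 * + 2) * k - k ≡⟨ ring (q /ℕ 2) k ⟩
  q /ℕ 2 * (+ 2 * k)         ∎))
  where
  ring : ∀ h k → (+ 1 + h * + 2) * k - k ≡ h * (+ 2 * k)
  ring = solve-∀
... | suc (suc _) | _  | ℕ.s≤s (ℕ.s≤s ())

Bpm-x≡orbit : ∀ m → Bpm (x m) ≡ orbit (y m) 0
Bpm-x≡orbit m = Bpm≡M^n (x m)

y-suc : ∀ m b → (m ℕ.+ 5) <∞? ν₂ (Bpm (x m)) ≡ b → y (suc m) ≡ (if b then y m else 2 ℕ.^ m ℕ.+ y m)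
y-suc m b test = cong (λ b → if b then y m else 2 ℕ.^ m ℕ.+ y m) test

-- Bpm is never compared with anything but itself below: unfolding a concrete Bpm n is exponential.
Bpm-x-divisible : ∀ m → 2^ (m ℕ.+ 5) ∣ Bpm (x m)
Bpm-x-divisible zero = subst (2^ 5 ∣_) (sym Bpm-x₀) (≡0-mod⇒∣ (Dec.from-yes (Bpm-fast 38 ≡? + 0 [mod 2^ 5 ])))
  where
  Bpm-x₀ : Bpm (x zero) ≡ Bpm-fast 38
  Bpm-x₀ = trans (Bpm-x≡orbit zero) (M^n-δ₀ 38)
Bpm-x-divisible (suc m) = by-test _ refl
  where
  B = Bpm (x m)
  v = orbit (y m)

  by-test : ∀ b → (m ℕ.+ 5) <∞? ν₂ B ≡ b → 2^ (suc m ℕ.+ 5) ∣ Bpm (x (suc m))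
  by-test true test = subst (2^ (suc m ℕ.+ 5) ∣_) (sym B′≡B)
                            (Equivalence.to (≤∞-ν₂ B (suc m ℕ.+ 5)) (<∞?-true (m ℕ.+ 5) _ test))
    where
    B′≡B : Bpm (x (suc m)) ≡ B
    B′≡B = begin
      Bpm (x (suc m))      ≡⟨ Bpm-x≡orbit (suc m) ⟩
      orbit (y (suc m)) 0  ≡⟨ cong (λ n → orbit n 0) (y-suc m true test) ⟩
      orbit (y m) 0        ≡⟨ sym (Bpm-x≡orbit m) ⟩
      B                    ∎
  by-test false test = ≡0-mod⇒∣ (≡-mod-trans (≡-mod-reflexive B′≡B+Dv) B+Dv≡0)
    where
    B′≡B+Dv : Bpm (x (suc m)) ≡ B + (E m −id) v 0
    B′≡B+Dv = begin
      Bpm (x (suc m))              ≡⟨ Bpm-x≡orbit (suc m) ⟩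
      orbit (y (suc m)) 0          ≡⟨ cong (λ n → orbit n 0) (y-suc m false test) ⟩
      orbit (2 ℕ.^ m ℕ.+ y m) 0    ≡⟨ cong-app (sym (E-orbit m (y m))) 0 ⟩
      E m v 0                      ≡⟨ ring (E m v 0) (v 0) ⟩
      v 0 + (E m −id) v 0          ≡⟨ cong (λ a → a + (E m −id) v 0) (sym (Bpm-x≡orbit m)) ⟩
      B + (E m −id) v 0            ∎
      where
      ring : ∀ a b → a ≡ b + (a - b)
      ring = solve-∀

    B≡2^[m+5] : B ≡ 2^ (m ℕ.+ 5) [mod 2^ (suc m ℕ.+ 5) ]
    B≡2^[m+5] = odd-multiple (2^ (m ℕ.+ 5)) B (Bpm-x-divisible m)
      (λ d → <∞?-false (m ℕ.+ 5) _ test (Equivalence.from (≤∞-ν₂ B (suc m ℕ.+ 5)) d))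

    Dv≡2^[m+5] : (E m −id) v 0 ≡ 2^ (m ℕ.+ 5) [mod 2^ (suc m ℕ.+ 5) ]
    Dv≡2^[m+5] = subst₂ (λ a b → (E m −id) v 0 ≡ 2^ a [mod 2^ b ]) (ℕP.+-comm 5 m) (cong suc (ℕP.+-comm 5 m)) (E−id-orbit m (y m))

    B+Dv≡0 : B + (E m −id) v 0 ≡ + 0 [mod 2^ (suc m ℕ.+ 5) ]
    B+Dv≡0 = ≡-mod-trans (+-cong-mod B≡2^[m+5] Dv≡2^[m+5]) (mod-∣ (divides (+ 1) (ring (2^ (m ℕ.+ 5)))))
      where
      ring : ∀ x → (x + x) - + 0 ≡ + 1 * (+ 2 * x)
      ring = solve-∀

lemma7p4 : (m : ℕ) → (m ℕ.+ 5) ≤∞ ν₂ (Bpm (x m))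
lemma7p4 m = Equivalence.from (≤∞-ν₂ (Bpm (x m)) (m ℕ.+ 5)) (Bpm-x-divisible m)
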